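{- $\mathsf{RC}\equiv_{sW}\mathsf D\equiv_{sW}\mathsf{WF}$.
   Context: $\equiv_{sW}$ denotes strong Weihrauch equivalence. Graphs are countable, given by vertex and edge sets. A coloring of a graph $G$ with vertex set $V$ is a map $c:V\to\mathbb N$ with $c(v_1)\ne c(v_2)$ whenever $(v_1,v_2)$ is an edge. $\mathsf{RC}$: given a graph $G$, output $1$ if there is a coloring of $G$ that uses one color infinitely often and $0$ otherwise. $\mathsf D$: given a graph $G$, output $1$ if $G$ has an infinite completely disconnected subgraph (an infinite set of vertices, no two of which are joined by an edge of $G$) and $0$ otherwise. $\mathsf{WF}$: given a tree $T\subseteq\mathbb N^{<\mathbb N}$, output $0$ if $T$ contains an infinite path and $1$ if not. -}

module Defs where

open import Level using (0ℓ)
open import Data.Bool using (Bool; true; false)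
open import Data.Nat using (ℕ; _≤_)
open import Data.List using (List; []; _∷_; _∷ʳ_)
open import Data.Product using (Σ; ∃; _×_; _,_)
open import Data.Sum using (_⊎_)
open import Relation.Nullary using (¬_)
open import Relation.Binary.PropositionalEquality using (_≡_; _≢_)
open import Axiom.ExcludedMiddle using (ExcludedMiddle)

-- Name  : type of (raw) names of inputs (functions on countable codes)
-- Valid : which names actually denote an input of the problem
-- Sol   : Sol x n  means  n is the (correct) output on input x

record Problem : Set₁ where
  field
    Name  : Set
    Valid : Name → Set
    Sol   : Name → ℕ → Set
open Problem public

-- The forward functional Φ and the
-- backward functional Ψ are Agda functions (hence computable); they
-- are chosen BEFORE excluded middle is assumed, so they cannot use it.
-- Correctness is verified classically (the paper's metatheory).
_≤sW_ : Problem → Problem → Set₁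
P ≤sW Q =
  Σ (Name P → Name Q) λ Φ →
  Σ (ℕ → ℕ) λ Ψ →
  ExcludedMiddle 0ℓ →
  ∀ x → Valid P x →
    Valid Q (Φ x) × (∀ y → Sol Q (Φ x) y → Sol P x (Ψ y))

_≡sW_ : Problem → Problem → Set₁
P ≡sW Q = (P ≤sW Q) × (Q ≤sW P)

record GraphName : Set where
  constructor graph
  field
    V : ℕ → Bool
    E : ℕ → ℕ → Bool
open GraphName public

IsGraph : GraphName → Set
IsGraph G =
  (∀ u v → E G u v ≡ true → (V G u ≡ true) × (V G v ≡ true)) ×
  (∀ u v → E G u v ≡ true → E G v u ≡ true) ×
  (∀ u → E G u u ≡ false)

-- coloring: c : V → ℕ (given on all of ℕ; values off V are irrelevant)
IsColoring : GraphName → (ℕ → ℕ) → Set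
IsColoring G c = ∀ u v → E G u v ≡ true → c u ≢ c v

UsesInfinitelyOften : GraphName → (ℕ → ℕ) → ℕ → Set
UsesInfinitelyOften G c k = ∀ n → ∃ λ v → (n ≤ v) × (V G v ≡ true) × (c v ≡ k)

HasRecurrentColoring : GraphName → Set
HasRecurrentColoring G =
  ∃ λ (c : ℕ → ℕ) → IsColoring G c × ∃ λ k → UsesInfinitelyOften G c k

HasInfiniteIndependent : GraphName → Set
HasInfiniteIndependent G =
  ∃ λ (S : ℕ → Bool) →
    (∀ v → S v ≡ true → V G v ≡ true) ×
    (∀ n → ∃ λ v → (n ≤ v) × (S v ≡ true)) ×
    (∀ u v → S u ≡ true → S v ≡ true → E G u v ≡ false)

RC : Problem
RC = record
  { Name  = GraphName
  ; Valid = IsGraph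
  ; Sol   = λ G b → ((b ≡ 1) × HasRecurrentColoring G)
                  ⊎ ((b ≡ 0) × ¬ HasRecurrentColoring G) }

D : Problem
D = record
  { Name  = GraphName
  ; Valid = IsGraph
  ; Sol   = λ G b → ((b ≡ 1) × HasInfiniteIndependent G)
                  ⊎ ((b ≡ 0) × ¬ HasInfiniteIndependent G) }

TreeName : Set
TreeName = List ℕ → Bool

IsTree : TreeName → Set
IsTree T = ∀ σ n → T (σ ∷ʳ n) ≡ true → T σ ≡ true

initial : (ℕ → ℕ) → ℕ → List ℕ
initial f ℕ.zero = []
initial f (ℕ.suc n) = initial f n ∷ʳ f n

HasInfinitePath : TreeName → Set
HasInfinitePath T = ∃ λ (f : ℕ → ℕ) → ∀ n → T (initial f n) ≡ true

WF : Problem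
WF = record
  { Name  = TreeName
  ; Valid = IsTree
  ; Sol   = λ T b → ((b ≡ 0) × HasInfinitePath T)
                  ⊎ ((b ≡ 1) × ¬ HasInfinitePath T) }

-- A colour used infinitely often is an infinite independent set, and conversely an infinite
-- independent set can be coloured 0 while every other vertex gets a colour of its own; so RC
-- and D ask the same question about the same graph.  An infinite independent set of G amounts
-- to an infinite increasing sequence of pairwise non-adjacent vertices, that is, a path through
-- the tree of finite such sequences.  Conversely a path through a tree T amounts to an infinite
-- independent set in the graph whose vertices are the codes of the nodes of T, two codes being
-- adjacent unless the smaller one denotes a proper initial segment of the larger one.  Excluded
-- middle is needed only to turn a sequence back into the set of its values.

module Submission where

open import Defs
open import Data.Product using (_×_)

open import Level using (0ℓ)
open import Data.Bool using (Bool; true; false; if_then_else_)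
import Data.Bool as Bool
open import Data.Bool.Properties using (¬-not)
open import Data.Fin as Fin using (fromℕ<)
open import Data.Fin.Properties using (toℕ-fromℕ<)
open import Data.List using (List; []; _∷_; _∷ʳ_; _++_; [_]; length; lookup; take; drop; applyUpTo)
open import Data.List.Properties
  using (++-identityʳ; ++-assoc; applyUpTo-∷ʳ; length-applyUpTo; take-suc; take++drop≡id)
open import Data.List.Relation.Binary.Prefix.Heterogeneous using (Prefix; []; _∷_)
open import Data.List.Relation.Binary.Prefix.Heterogeneous.Properties using (prefix?)
open import Data.List.Relation.Unary.All as All using (All; []; _∷_; all?)
import Data.List.Relation.Unary.All.Properties as All
open import Data.List.Relation.Unary.AllPairs using (AllPairs; []; _∷_; allPairs?)
import Data.List.Relation.Unary.AllPairs.Properties as AllPairs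
open import Data.Nat using (ℕ; zero; suc; _≤_; _<_; z≤n; s≤s; _<?_)
import Data.Nat as ℕ
open import Data.Nat.Properties
  using (<-trans; ≤-<-trans; <⇒≤; <-irrefl; <-asym; <-cmp; n<1+n; m<1+n⇒m<n∨m≡n; *-monoʳ-<)
open import Data.Nat.Binary using (ℕᵇ; 2[1+_]; 1+[2_]; toℕ; fromℕ)
import Data.Nat.Binary as ℕᵇ
open import Data.Nat.Binary.Properties using (fromℕ-toℕ)
open import Data.Product using (∃; _,_; proj₁; proj₂)
open import Data.Sum using (_⊎_; inj₁; inj₂; swap)
open import Function using (id; _∘_; _⇔_; mk⇔; Equivalence)
import Function.Properties.Equivalence as ⇔
open import Relation.Binary using (tri<; tri≈; tri>)
open import Relation.Binary.PropositionalEquality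
  using (_≡_; _≢_; refl; sym; trans; cong; subst; subst₂; module ≡-Reasoning)
open import Relation.Nullary using (¬_; Dec; yes; does; _×-dec_; _⊎-dec_; ¬?)
open import Relation.Nullary.Decidable using (dec-true; dec-false; decidable-stable)
open import Axiom.ExcludedMiddle using (ExcludedMiddle)

open Equivalence using (to; from)

true≢false : true ≢ false
true≢false ()

does≡true⇒ : ∀ {A : Set} (a? : Dec A) → does a? ≡ true → A
does≡true⇒ (yes a) _ = a

does≡false⇒¬ : ∀ {A : Set} (a? : Dec A) → does a? ≡ false → ¬ A
does≡false⇒¬ a? eq a with () ← trans (sym (dec-true a? a)) eq

stepwise⇒<-monotone : ∀ {g : ℕ → ℕ} → (∀ n → g n < g (suc n)) → ∀ {i j} → i < j → g i < g j
stepwise⇒<-monotone inc {j = suc j} i<1+j with m<1+n⇒m<n∨m≡n i<1+j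
... | inj₁ i<j  = <-trans (stepwise⇒<-monotone inc i<j) (inc j)
... | inj₂ refl = inc j

<-monotone⇒n≤ : ∀ {g : ℕ → ℕ} → (∀ {i j} → i < j → g i < g j) → ∀ n → n ≤ g n
<-monotone⇒n≤ mono zero    = z≤n
<-monotone⇒n≤ mono (suc n) = ≤-<-trans (<-monotone⇒n≤ mono n) (mono (n<1+n n))

module _ {G : GraphName} where

  recurrent⇒independent : HasRecurrentColoring G → HasInfiniteIndependent G
  recurrent⇒independent (c , coloring , k , often) = colorClass , inV , infinite , independent
    where
    inClass? : ∀ v → Dec ((V G v ≡ true) × (c v ≡ k))
    inClass? v = V G v Bool.≟ true ×-dec c v ℕ.≟ k

    colorClass : ℕ → Bool
    colorClass v = does (inClass? v)

    inClass : ∀ {v} → colorClass v ≡ true → (V G v ≡ true) × (c v ≡ k)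
    inClass {v} = does≡true⇒ (inClass? v)

    inV : ∀ v → colorClass v ≡ true → V G v ≡ true
    inV v = proj₁ ∘ inClass

    infinite : ∀ n → ∃ λ v → (n ≤ v) × (colorClass v ≡ true)
    infinite n with often n
    ... | v , n≤v , Vv , cv≡k = v , n≤v , dec-true (inClass? v) (Vv , cv≡k)

    independent : ∀ u v → colorClass u ≡ true → colorClass v ≡ true → E G u v ≡ false
    independent u v u∈ v∈ = ¬-not λ edge →
      coloring u v edge (trans (proj₂ (inClass u∈)) (sym (proj₂ (inClass v∈))))

  independent⇒recurrent : IsGraph G → HasInfiniteIndependent G → HasRecurrentColoring G
  independent⇒recurrent (_ , _ , loopless) (S , S⊆V , infinite , independent) =
    c , coloring , 0 , often
    where
    c : ℕ → ℕ
    c v = if S v then 0 else suc v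

    coloring : IsColoring G c
    coloring u v edge with S u in u∈ | S v in v∈
    ... | true  | true  = λ _ → true≢false (trans (sym edge) (independent u v u∈ v∈))
    ... | true  | false = λ ()
    ... | false | true  = λ ()
    ... | false | false = λ { refl → true≢false (trans (sym edge) (loopless u)) }

    often : UsesInfinitelyOften G c 0
    often n with infinite n
    ... | v , n≤v , v∈ = v , n≤v , S⊆V v v∈ , cong (if_then 0 else suc v) v∈

  recurrent⇔independent : IsGraph G → HasRecurrentColoring G ⇔ HasInfiniteIndependent G
  recurrent⇔independent isGraph = mk⇔ recurrent⇒independent (independent⇒recurrent isGraph)

IncreasingNonEdge : GraphName → ℕ → ℕ → Set
IncreasingNonEdge G u v = (u < v) × (E G u v ≡ false)

IndependentSequence : GraphName → (ℕ → ℕ) → Set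
IndependentSequence G g =
  (∀ n → V G (g n) ≡ true) × (∀ {i j} → i < j → IncreasingNonEdge G (g i) (g j))

enumerate : ∀ {S : ℕ → Bool} → (∀ n → ∃ λ v → (n ≤ v) × (S v ≡ true)) →
            ∃ λ (g : ℕ → ℕ) → (∀ k → S (g k) ≡ true) × (∀ k → g k < g (suc k))
enumerate {S} infinite = g , inS , increasing
  where
  g : ℕ → ℕ
  g zero    = proj₁ (infinite 0)
  g (suc k) = proj₁ (infinite (suc (g k)))

  inS : ∀ k → S (g k) ≡ true
  inS zero    = proj₂ (proj₂ (infinite 0))
  inS (suc k) = proj₂ (proj₂ (infinite (suc (g k))))

  increasing : ∀ k → g k < g (suc k)
  increasing k = proj₁ (proj₂ (infinite (suc (g k))))

module _ {G : GraphName} where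

  independent⇒sequence : HasInfiniteIndependent G → ∃ (IndependentSequence G)
  independent⇒sequence (S , S⊆V , infinite , independent) with enumerate infinite
  ... | g , inS , increasing =
    g , (λ n → S⊆V (g n) (inS n)) ,
    λ {i} {j} i<j → stepwise⇒<-monotone increasing i<j , independent (g i) (g j) (inS i) (inS j)

  sequence⇒independent : ExcludedMiddle 0ℓ → IsGraph G → ∃ (IndependentSequence G) →
                         HasInfiniteIndependent G
  sequence⇒independent lem (_ , symmetric , loopless) (g , inV , pairs) =
    range , range⊆V , infinite , independent
    where
    InRange : ℕ → Set
    InRange v = ∃ λ n → g n ≡ v

    range : ℕ → Bool
    range v = does (lem {InRange v})

    range⊆V : ∀ v → range v ≡ true → V G v ≡ true
    range⊆V v v∈ with does≡true⇒ lem v∈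
    ... | n , refl = inV n

    infinite : ∀ n → ∃ λ v → (n ≤ v) × (range v ≡ true)
    infinite n = g n , <-monotone⇒n≤ (proj₁ ∘ pairs) n , dec-true lem (n , refl)

    nonEdge : ∀ i j → E G (g i) (g j) ≡ false
    nonEdge i j with <-cmp i j
    ... | tri< i<j _ _ = proj₂ (pairs i<j)
    ... | tri≈ _ refl _ = loopless (g i)
    ... | tri> _ _ j<i = ¬-not λ edge →
      true≢false (trans (sym (symmetric _ _ edge)) (proj₂ (pairs j<i)))

    independent : ∀ u v → range u ≡ true → range v ≡ true → E G u v ≡ false
    independent u v u∈ v∈ with does≡true⇒ lem u∈ | does≡true⇒ lem v∈
    ... | i , refl | j , refl = nonEdge i j

  independent⇔sequence : ExcludedMiddle 0ℓ → IsGraph G →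
                         HasInfiniteIndependent G ⇔ ∃ (IndependentSequence G)
  independent⇔sequence lem isGraph = mk⇔ independent⇒sequence (sequence⇒independent lem isGraph)

initial≡applyUpTo : ∀ f n → initial f n ≡ applyUpTo f n
initial≡applyUpTo f zero    = refl
initial≡applyUpTo f (suc n) = trans (cong (_∷ʳ f n) (initial≡applyUpTo f n)) (applyUpTo-∷ʳ f n)

module _ {A : Set} {R : A → A → Set} where

  allPairs-++⁻ˡ : ∀ xs {ys} → AllPairs R (xs ++ ys) → AllPairs R xs
  allPairs-++⁻ˡ []       _          = []
  allPairs-++⁻ˡ (x ∷ xs) (px ∷ pxs) = All.++⁻ˡ xs px ∷ allPairs-++⁻ˡ xs pxs

  allPairs-applyUpTo⁻ : ∀ f n → AllPairs R (applyUpTo f n) →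
                        ∀ {i j} → i < j → j < n → R (f i) (f j)
  allPairs-applyUpTo⁻ f (suc n) (px ∷ _) {zero} {suc j} _ (s≤s j<n) =
    All.applyUpTo⁻ (f ∘ suc) n px j<n
  allPairs-applyUpTo⁻ f (suc n) (_ ∷ pxs) {suc i} {suc j} (s≤s i<j) (s≤s j<n) =
    allPairs-applyUpTo⁻ (f ∘ suc) n pxs i<j j<n

IndependentList : GraphName → List ℕ → Set
IndependentList G σ = All (λ v → V G v ≡ true) σ × AllPairs (IncreasingNonEdge G) σ

independentList? : ∀ G σ → Dec (IndependentList G σ)
independentList? G σ =
  all? (λ v → V G v Bool.≟ true) σ ×-dec
  allPairs? (λ u v → u <? v ×-dec E G u v Bool.≟ false) σ

independenceTree : GraphName → TreeName
independenceTree G σ = does (independentList? G σ)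

module _ {G : GraphName} where

  independenceTree-isTree : IsTree (independenceTree G)
  independenceTree-isTree σ n inT with does≡true⇒ (independentList? G (σ ∷ʳ n)) inT
  ... | inV , pairs = dec-true (independentList? G σ) (All.++⁻ˡ σ inV , allPairs-++⁻ˡ σ pairs)

  initial∈tree⇔independentList : ∀ g n →
    independenceTree G (initial g n) ≡ true ⇔ IndependentList G (applyUpTo g n)
  initial∈tree⇔independentList g n rewrite initial≡applyUpTo g n =
    mk⇔ (does≡true⇒ (independentList? G _)) (dec-true (independentList? G _))

  path⇔sequence : HasInfinitePath (independenceTree G) ⇔ ∃ (IndependentSequence G)
  path⇔sequence = mk⇔ path⇒sequence sequence⇒path
    where
    path⇒sequence : HasInfinitePath (independenceTree G) → ∃ (IndependentSequence G)
    path⇒sequence (f , path) =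
      f , (λ n → All.applyUpTo⁻ f (suc n) (proj₁ (onPath (suc n))) (n<1+n n)) ,
      λ {i} {j} i<j → allPairs-applyUpTo⁻ f (suc j) (proj₂ (onPath (suc j))) i<j (n<1+n j)
      where
      onPath : ∀ n → IndependentList G (applyUpTo f n)
      onPath n = to (initial∈tree⇔independentList f n) (path n)

    sequence⇒path : ∃ (IndependentSequence G) → HasInfinitePath (independenceTree G)
    sequence⇒path (g , inV , pairs) = g , λ n → from (initial∈tree⇔independentList g n)
      (All.applyUpTo⁺₂ g n inV , AllPairs.applyUpTo⁺₁ g n (λ i<j _ → pairs i<j))

-- Lists are coded in bijective base 2 (digits 1 and 2, least significant first): an entry a
-- is written as a digits 1 closed by a digit 2, so that decoding is structural recursion.
prependOnes : ℕ → ℕᵇ → ℕᵇ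
prependOnes zero    x = x
prependOnes (suc a) x = 1+[2 prependOnes a x ]

encodeᵇ : List ℕ → ℕᵇ
encodeᵇ []      = ℕᵇ.zero
encodeᵇ (a ∷ σ) = prependOnes a 2[1+ encodeᵇ σ ]

incrementHead : List ℕ → List ℕ
incrementHead []      = []
incrementHead (a ∷ σ) = suc a ∷ σ

decodeᵇ : ℕᵇ → List ℕ
decodeᵇ ℕᵇ.zero  = []
decodeᵇ 2[1+ x ] = 0 ∷ decodeᵇ x
decodeᵇ 1+[2 x ] = incrementHead (decodeᵇ x)

decodeᵇ-prependOnes : ∀ a x → decodeᵇ (prependOnes a 2[1+ x ]) ≡ a ∷ decodeᵇ x
decodeᵇ-prependOnes zero    x = refl
decodeᵇ-prependOnes (suc a) x = cong incrementHead (decodeᵇ-prependOnes a x)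

decodeᵇ-encodeᵇ : ∀ σ → decodeᵇ (encodeᵇ σ) ≡ σ
decodeᵇ-encodeᵇ []      = refl
decodeᵇ-encodeᵇ (a ∷ σ) =
  trans (decodeᵇ-prependOnes a (encodeᵇ σ)) (cong (a ∷_) (decodeᵇ-encodeᵇ σ))

encode : List ℕ → ℕ
encode σ = toℕ (encodeᵇ σ)

decode : ℕ → List ℕ
decode v = decodeᵇ (fromℕ v)

decode-encode : ∀ σ → decode (encode σ) ≡ σ
decode-encode σ = trans (cong decodeᵇ (fromℕ-toℕ (encodeᵇ σ))) (decodeᵇ-encodeᵇ σ)

prependOnes-mono-< : ∀ a {x y} → toℕ x < toℕ y → toℕ (prependOnes a x) < toℕ (prependOnes a y)
prependOnes-mono-< zero    x<y = x<y
prependOnes-mono-< (suc a) x<y = s≤s (*-monoʳ-< 2 (prependOnes-mono-< a x<y))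

encode<encode-∷ʳ : ∀ σ x → encode σ < encode (σ ∷ʳ x)
encode<encode-∷ʳ []      x =
  ≤-<-trans z≤n (prependOnes-mono-< x {ℕᵇ.zero} {2[1+ ℕᵇ.zero ]} (s≤s z≤n))
encode<encode-∷ʳ (a ∷ σ) x = prependOnes-mono-< a (*-monoʳ-< 2 (s≤s (encode<encode-∷ʳ σ x)))

_⊑_ : List ℕ → List ℕ → Set
_⊑_ = Prefix _≡_

_⊏_ : List ℕ → List ℕ → Set
σ ⊏ τ = (σ ⊑ τ) × (length σ < length τ)

_⊏?_ : ∀ σ τ → Dec (σ ⊏ τ)
σ ⊏? τ = prefix? ℕ._≟_ σ τ ×-dec length σ <? length τ

⊑⇒take≡take : ∀ {σ τ} n → σ ⊑ τ → n ≤ length σ → take n σ ≡ take n τ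
⊑⇒take≡take zero    _          _         = refl
⊑⇒take≡take (suc n) (refl ∷ p) (s≤s n≤) = cong (_ ∷_) (⊑⇒take≡take n p n≤)

applyUpTo-⊑ : ∀ (f : ℕ → ℕ) {i j} → i ≤ j → applyUpTo f i ⊑ applyUpTo f j
applyUpTo-⊑ f {zero}              _         = []
applyUpTo-⊑ f {suc i} {suc j} (s≤s i≤j) = refl ∷ applyUpTo-⊑ (f ∘ suc) i≤j

initial-⊏ : ∀ f {i j} → i < j → initial f i ⊏ initial f j
initial-⊏ f {i} {j} i<j rewrite initial≡applyUpTo f i | initial≡applyUpTo f j
                              | length-applyUpTo f i | length-applyUpTo f j =
  applyUpTo-⊑ f (<⇒≤ i<j) , i<j

module _ {T : TreeName} (isTree : IsTree T) where

  tree-++⁻ˡ : ∀ σ ρ → T (σ ++ ρ) ≡ true → T σ ≡ true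
  tree-++⁻ˡ σ []      inT = subst (λ τ → T τ ≡ true) (++-identityʳ σ) inT
  tree-++⁻ˡ σ (x ∷ ρ) inT =
    isTree σ x (tree-++⁻ˡ (σ ∷ʳ x) ρ (subst (λ τ → T τ ≡ true) (sym (++-assoc σ [ x ] ρ)) inT))

  tree-take : ∀ n σ → T σ ≡ true → T (take n σ) ≡ true
  tree-take n σ inT =
    tree-++⁻ˡ (take n σ) (drop n σ) (subst (λ τ → T τ ≡ true) (sym (take++drop≡id n σ)) inT)

  chain⇒path : (L : ℕ → List ℕ) → (∀ k → T (L k) ≡ true) → (∀ k → L k ⊏ L (suc k)) →
               HasInfinitePath T
  chain⇒path L inT chain =
    f , λ n → subst (λ σ → T σ ≡ true) (sym (initial≡take n)) (tree-take n (L n) (inT n))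
    where
    k≤length : ∀ k → k ≤ length (L k)
    k≤length zero    = z≤n
    k≤length (suc k) = ≤-<-trans (k≤length k) (proj₂ (chain k))

    f : ℕ → ℕ
    f n = lookup (L (suc n)) (fromℕ< (k≤length (suc n)))

    initial≡take : ∀ n → initial f n ≡ take n (L n)
    initial≡take zero    = refl
    initial≡take (suc n) = begin
      initial f n ∷ʳ f n
        ≡⟨ cong (_∷ʳ f n) (initial≡take n) ⟩
      take n (L n) ∷ʳ f n
        ≡⟨ cong (_∷ʳ f n) (⊑⇒take≡take n (proj₁ (chain n)) (k≤length n)) ⟩
      take n (L (suc n)) ∷ʳ f n
        ≡⟨ cong (λ m → take m (L (suc n)) ∷ʳ f n) (sym (toℕ-fromℕ< n<length)) ⟩
      take (Fin.toℕ i) (L (suc n)) ∷ʳ lookup (L (suc n)) i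
        ≡⟨ take-suc (L (suc n)) i ⟨
      take (suc (Fin.toℕ i)) (L (suc n))
        ≡⟨ cong (λ m → take (suc m) (L (suc n))) (toℕ-fromℕ< n<length) ⟩
      take (suc n) (L (suc n))
        ∎
      where
      open ≡-Reasoning
      n<length = k≤length (suc n)
      i = fromℕ< n<length

Unchained : ℕ → ℕ → Set
Unchained u v = (u < v) × ¬ (decode u ⊏ decode v)

ChainEdge : TreeName → ℕ → ℕ → Set
ChainEdge T u v = (T (decode u) ≡ true) × (T (decode v) ≡ true) × (Unchained u v ⊎ Unchained v u)

chainEdge? : ∀ T u v → Dec (ChainEdge T u v)
chainEdge? T u v = T (decode u) Bool.≟ true ×-dec T (decode v) Bool.≟ true ×-dec
                   (unchained? u v ⊎-dec unchained? v u)
  where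
  unchained? : ∀ u v → Dec (Unchained u v)
  unchained? u v = u <? v ×-dec ¬? (decode u ⊏? decode v)

chainGraph : TreeName → GraphName
chainGraph T = graph (T ∘ decode) (λ u v → does (chainEdge? T u v))

module _ {T : TreeName} where

  chainGraph-isGraph : IsGraph (chainGraph T)
  chainGraph-isGraph = endpoints , symmetric , loopless
    where
    endpoints : ∀ u v → E (chainGraph T) u v ≡ true →
                (T (decode u) ≡ true) × (T (decode v) ≡ true)
    endpoints u v edge with does≡true⇒ (chainEdge? T u v) edge
    ... | inU , inV , _ = inU , inV

    symmetric : ∀ u v → E (chainGraph T) u v ≡ true → E (chainGraph T) v u ≡ true
    symmetric u v edge with does≡true⇒ (chainEdge? T u v) edge
    ... | inU , inV , unchained = dec-true (chainEdge? T v u) (inV , inU , swap unchained)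

    loopless : ∀ u → E (chainGraph T) u u ≡ false
    loopless u = dec-false (chainEdge? T u u) λ where
      (_ , _ , inj₁ (u<u , _)) → <-irrefl refl u<u
      (_ , _ , inj₂ (u<u , _)) → <-irrefl refl u<u

  path⇒chainSequence : HasInfinitePath T → ∃ (IndependentSequence (chainGraph T))
  path⇒chainSequence (f , path) = g , inV , λ i<j → increasing i<j , nonEdge i<j
    where
    g : ℕ → ℕ
    g n = encode (initial f n)

    decode-g : ∀ n → decode (g n) ≡ initial f n
    decode-g n = decode-encode (initial f n)

    inV : ∀ n → T (decode (g n)) ≡ true
    inV n = subst (λ σ → T σ ≡ true) (sym (decode-g n)) (path n)

    increasing : ∀ {i j} → i < j → g i < g j
    increasing = stepwise⇒<-monotone λ n → encode<encode-∷ʳ (initial f n) (f n)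

    nonEdge : ∀ {i j} → i < j → E (chainGraph T) (g i) (g j) ≡ false
    nonEdge {i} {j} i<j = dec-false (chainEdge? T (g i) (g j)) λ where
      (_ , _ , inj₁ (_ , ¬⊏)) →
        ¬⊏ (subst₂ _⊏_ (sym (decode-g i)) (sym (decode-g j)) (initial-⊏ f i<j))
      (_ , _ , inj₂ (gj<gi , _)) → <-asym (increasing i<j) gj<gi

  chainSequence⇒path : IsTree T → ∃ (IndependentSequence (chainGraph T)) → HasInfinitePath T
  chainSequence⇒path isTree (g , inV , pairs) = chain⇒path isTree (decode ∘ g) inV chain
    where
    chain : ∀ k → decode (g k) ⊏ decode (g (suc k))
    chain k = decidable-stable (_ ⊏? _) λ ¬⊏ →
      does≡false⇒¬ (chainEdge? T _ _) (proj₂ (pairs (n<1+n k)))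
        (inV k , inV (suc k) , inj₁ (proj₁ (pairs (n<1+n k)) , ¬⊏))

  path⇔chainSequence : IsTree T → HasInfinitePath T ⇔ ∃ (IndependentSequence (chainGraph T))
  path⇔chainSequence isTree = mk⇔ path⇒chainSequence (chainSequence⇒path isTree)

independent⇔path : ExcludedMiddle 0ℓ → ∀ {G} → IsGraph G →
                   HasInfiniteIndependent G ⇔ HasInfinitePath (independenceTree G)
independent⇔path lem isGraph = ⇔.trans (independent⇔sequence lem isGraph) (⇔.sym path⇔sequence)

path⇔independent : ExcludedMiddle 0ℓ → ∀ {T} → IsTree T →
                   HasInfinitePath T ⇔ HasInfiniteIndependent (chainGraph T)
path⇔independent lem {T} isTree =
  ⇔.trans (path⇔chainSequence isTree) (⇔.sym (independent⇔sequence lem (chainGraph-isGraph {T})))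

Answer : Set → ℕ → ℕ → ℕ → Set
Answer A y n b = ((b ≡ y) × A) ⊎ ((b ≡ n) × ¬ A)

answer-map : ∀ {A B : Set} {y n y′ n′ b} (ψ : ℕ → ℕ) →
             A ⇔ B → ψ y ≡ y′ → ψ n ≡ n′ → Answer B y n b → Answer A y′ n′ (ψ b)
answer-map ψ A⇔B ψy ψn (inj₁ (refl , b))  = inj₁ (ψy , from A⇔B b)
answer-map ψ A⇔B ψy ψn (inj₂ (refl , ¬b)) = inj₂ (ψn , ¬b ∘ to A⇔B)

negate : ℕ → ℕ
negate zero    = 1
negate (suc _) = 0

RC≤D : RC ≤sW D
RC≤D = id , id , λ _ _ isGraph →
  isGraph , λ _ → answer-map id (recurrent⇔independent isGraph) refl refl

D≤RC : D ≤sW RC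
D≤RC = id , id , λ _ _ isGraph →
  isGraph , λ _ → answer-map id (⇔.sym (recurrent⇔independent isGraph)) refl refl

D≤WF : D ≤sW WF
D≤WF = independenceTree , negate , λ lem _ isGraph →
  independenceTree-isTree , λ _ → answer-map negate (independent⇔path lem isGraph) refl refl

WF≤D : WF ≤sW D
WF≤D = chainGraph , negate , λ lem T isTree →
  chainGraph-isGraph {T} , λ _ → answer-map negate (path⇔independent lem isTree) refl refl

theorem29 : (RC ≡sW D) × (D ≡sW WF)
theorem29 = (RC≤D , D≤RC) , (D≤WF , WF≤D)
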